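{- The free product of transversal matroids is a transversal matroid: if $M$ on $S$ and $N$ on $T$ ($S\cap T=\emptyset$) are transversal matroids, then $M\mathbin{\Box} N$ is transversal.
   Context: For a matroid $M$ on $S$, $\rho(M)$ is its rank, $\nu_M(A)=|A|-\rho_M(A)$, $\lambda_M(A)=\rho(M)-\rho_M(A)$. The free product $M\mathbin{\Box} N$ is the matroid on $S\cup T$ whose independent sets are the $A\subseteq S\cup T$ with $A\cap S$ independent in $M$ and $\lambda_M(A\cap S)\geq\nu_N(A\cap T)$. A matroid on $S$ is transversal if there is an indexed family $(A_i)_{i\in I}$ of subsets of $S$ such that its independent sets are exactly the partial transversals, i.e. sets $A$ admitting an injection $f:A\to I$ with $a\in A_{f(a)}$ for all $a\in A$. -}

module Defs where

open import Level using (0ℓ)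
open import Data.Nat using (ℕ; _+_; _≤_; _<_; _∸_)
open import Data.Fin using (Fin)
open import Data.Fin.Subset using (Subset; _∈_; _⊆_; ∣_∣; ⊤; ⊥; _∪_; ⁅_⁆; _∉_)
open import Data.Vec using (take; drop)
open import Data.Product using (Σ; ∃; _×_; _,_)
open import Relation.Binary.PropositionalEquality using (_≡_)
open import Function.Bundles using (_⇔_)

record Matroid (n : ℕ) : Set₁ where
  field
    Indep      : Subset n → Set
    indep-∅    : Indep ⊥
    hereditary : ∀ {A B} → B ⊆ A → Indep A → Indep B
    augment    : ∀ {A B} → Indep A → Indep B → ∣ A ∣ < ∣ B ∣ →
                 ∃ λ x → x ∈ B × x ∉ A × Indep (A ∪ ⁅ x ⁆)
open Matroid public

IsRank : ∀ {n} → Matroid n → Subset n → ℕ → Set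
IsRank M A r =
  (∃ λ B → B ⊆ A × Indep M B × ∣ B ∣ ≡ r) ×
  (∀ B → B ⊆ A → Indep M B → ∣ B ∣ ≤ r)

-- Ground set of the free product: S = Fin m (first m points), T = Fin n
-- (last n points) of Fin (m + n); A ∩ S = take m A, A ∩ T = drop m A.
-- Independent sets of M □ N: A ∩ S independent in M and
--   λ_M(A ∩ S) ≥ ν_N(A ∩ T), i.e.  ρ(M) - ρ_M(A∩S) ≥ |A∩T| - ρ_N(A∩T)
-- (both differences are nonnegative, so truncated subtraction is exact).
FreeProductIndep : ∀ {m n} → Matroid m → Matroid n → Subset (m + n) → Set
FreeProductIndep {m} {n} M N A =
  Indep M (take m A) ×
  Σ ℕ λ ρM → Σ ℕ λ ρS → Σ ℕ λ ρT →
    IsRank M ⊤ ρM × IsRank M (take m A) ρS × IsRank N (drop m A) ρT ×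
    (∣ drop m A ∣ ∸ ρT) ≤ (ρM ∸ ρS)

IsPartialTransversal : ∀ {n k} → (Fin k → Subset n) → Subset n → Set
IsPartialTransversal {n} {k} fam A =
  Σ ((a : Fin n) → a ∈ A → Fin k) λ f →
    (∀ a b (a∈ : a ∈ A) (b∈ : b ∈ A) → f a a∈ ≡ f b b∈ → a ≡ b) ×
    (∀ a (a∈ : a ∈ A) → a ∈ fam (f a a∈))

IsTransversalIndep : ∀ {n} → (Subset n → Set) → Set
IsTransversalIndep {n} I =
  Σ ℕ λ k → Σ (Fin k → Subset n) λ fam →
    ∀ A → I A ⇔ IsPartialTransversal fam A

IsTransversal : ∀ {n} → Matroid n → Set
IsTransversal M = IsTransversalIndep (Indep M)

-- A transversal matroid M presented by a family (A_i) is already presented by the ρ(M) sets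
-- A_i that a matching g of a basis B uses. Indeed, if a matching of X puts x₀ into a set A_{i₀}
-- not used by g, then x₀ ∈ B by maximality of B. Once x₀ and the slot i₀ are deleted, B - x₀ is
-- a maximum partial transversal, so by induction on |B| the set X - x₀ can be rematched into the
-- slots of B - x₀, which leaves the slot g(x₀) for x₀.
--
-- Given such a presentation (A_i)_{i ∈ I} of M with |I| = ρ(M) and a presentation (B_j) of N,
-- the free product M □ N is presented by the sets A_i ∪ T (i ∈ I) together with the B_j. If A is
-- independent in M □ N, match A ∩ S into the A_i and a basis Y of A ∩ T into the B_j; the
-- ν_N(A ∩ T) elements of (A ∩ T) - Y fit into the λ_M(A ∩ S) slots of I left unused by A ∩ S.
-- Conversely, a matching of A puts at most |I| = ρ(M) elements into the sets A_i ∪ T and at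
-- most ρ_N(A ∩ T) into the B_j, so |A ∩ S| + |A ∩ T| ≤ ρ(M) + ρ_N(A ∩ T).

module Submission where

open import Defs
open import Data.Nat using (ℕ; zero; suc; _+_; _≤_; _<_; _∸_; z≤n; s≤s; s≤s⁻¹)
open import Data.Nat.Properties
open import Data.Fin using (Fin; zero; suc; _↑ˡ_; _↑ʳ_; splitAt; punchIn; punchOut)
open import Data.Fin.Properties as Fin using (↑ˡ-injective; ↑ʳ-injective)
open import Data.Fin.Subset
open import Data.Fin.Subset.Properties
open import Data.Vec using ([]; _∷_; _++_; take; drop; tabulate; lookup; here; there)
open import Data.Vec.Properties
  using ([]=⇒lookup; lookup⇒[]=; lookup∘tabulate; take++drop≡id; lookup-++ˡ; lookup-++ʳ)
open import Data.Vec.Properties.WithK using ([]=-irrelevant)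
open import Data.Vec.Functional using () renaming (_++_ to _⊕_)
open import Data.Vec.Functional.Properties using () renaming (lookup-++ˡ to ⊕-↑ˡ; lookup-++ʳ to ⊕-↑ʳ)
open import Data.Bool using (if_then_else_)
open import Data.Product using (Σ; ∃; ∃₂; _×_; _,_; proj₁; proj₂)
open import Data.Sum using (_⊎_; inj₁; inj₂; [_,_])
open import Data.Empty using (⊥-elim)
open import Function using (_∘_; id)
open import Function.Bundles using (_⇔_; Equivalence; mk⇔)
open import Function.Construct.Composition using (_⇔-∘_)
open import Relation.Nullary using (Dec; yes; no; does; contradiction)
open import Relation.Nullary.Decidable using (_×-dec_; _⊎-dec_; map′)
open import Relation.Unary using (Decidable)
open import Relation.Binary.PropositionalEquality hiding ([_])

private
  variable
    k l m n : ℕ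

x∈p─q⁻ : ∀ (p q : Subset n) {x} → x ∈ p ─ q → x ∈ p × x ∉ q
x∈p─q⁻ (inside ∷ p)  (outside ∷ q) here = here , λ ()
x∈p─q⁻ (inside ∷ p)  (inside ∷ q)  {zero} ()
x∈p─q⁻ (outside ∷ p) (inside ∷ q)  {zero} ()
x∈p─q⁻ (outside ∷ p) (outside ∷ q) {zero} ()
x∈p─q⁻ (s ∷ p) (t ∷ q) (there x∈) with x∈p─q⁻ p q x∈
... | x∈p , x∉q = there x∈p , x∉q ∘ drop-there

x∈p-y⇒x≢y : ∀ {p : Subset n} {x y} → x ∈ p - y → x ≢ y
x∈p-y⇒x≢y {p = p} {y = y} x∈ = x∉⁅y⁆⇒x≢y (proj₂ (x∈p─q⁻ p ⁅ y ⁆ x∈))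

p⊆p-x∪⁅x⁆ : ∀ (p : Subset n) x → p ⊆ (p - x) ∪ ⁅ x ⁆
p⊆p-x∪⁅x⁆ p x {y} y∈p with y Fin.≟ x
... | yes refl = x∈p∪q⁺ (inj₂ (x∈⁅x⁆ x))
... | no y≢x   = x∈p∪q⁺ (inj₁ (x∈p∧x≢y⇒x∈p-y y∈p y≢x))

p∪⁅x⁆-x⊆p : ∀ (p : Subset n) x → (p ∪ ⁅ x ⁆) - x ⊆ p
p∪⁅x⁆-x⊆p p x {y} y∈ with x∈p─q⁻ (p ∪ ⁅ x ⁆) ⁅ x ⁆ y∈
... | y∈p∪x , y∉x with x∈p∪q⁻ p ⁅ x ⁆ y∈p∪x
...   | inj₁ y∈p = y∈p
...   | inj₂ y∈x = contradiction y∈x y∉x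

subset : {P : Fin n → Set} → Decidable P → Subset n
subset P? = tabulate (does ∘ P?)

∈-subset⁺ : {P : Fin n → Set} (P? : Decidable P) → ∀ {x} → P x → x ∈ subset P?
∈-subset⁺ P? {x} px = lookup⇒[]= x _ (trans (lookup∘tabulate (does ∘ P?) x) (true-if (P? x)))
  where
  true-if : (d : Dec _) → does d ≡ inside
  true-if (yes _) = refl
  true-if (no ¬px) = contradiction px ¬px

∈-subset⁻ : {P : Fin n → Set} (P? : Decidable P) → ∀ {x} → x ∈ subset P? → P x
∈-subset⁻ {P = P} P? {x} x∈ = holds (P? x) (trans (sym (lookup∘tabulate (does ∘ P?) x)) ([]=⇒lookup x∈))
  where
  holds : (d : Dec (P x)) → does d ≡ inside → P x
  holds (yes px) _ = px

∃∈? : ∀ {p : Subset n} {x} {Q : x ∈ p → Set} → (∀ x∈ → Dec (Q x∈)) → Dec (Σ (x ∈ p) Q)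
∃∈? {p = p} {x} {Q} Q? with x ∈? p
... | no x∉p = no (x∉p ∘ proj₁)
... | yes x∈p = map′ (x∈p ,_) (λ { (x∈p′ , q) → subst Q ([]=-irrelevant x∈p′ x∈p) q }) (Q? x∈p)

∣p─q∣+∣p∩q∣≡∣p∣ : ∀ (p q : Subset n) → ∣ p ─ q ∣ + ∣ p ∩ q ∣ ≡ ∣ p ∣
∣p─q∣+∣p∩q∣≡∣p∣ []            []            = refl
∣p─q∣+∣p∩q∣≡∣p∣ (inside ∷ p)  (inside ∷ q)  = trans (+-suc _ _) (cong suc (∣p─q∣+∣p∩q∣≡∣p∣ p q))
∣p─q∣+∣p∩q∣≡∣p∣ (inside ∷ p)  (outside ∷ q) = cong suc (∣p─q∣+∣p∩q∣≡∣p∣ p q)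
∣p─q∣+∣p∩q∣≡∣p∣ (outside ∷ p) (inside ∷ q)  = ∣p─q∣+∣p∩q∣≡∣p∣ p q
∣p─q∣+∣p∩q∣≡∣p∣ (outside ∷ p) (outside ∷ q) = ∣p─q∣+∣p∩q∣≡∣p∣ p q

∣p∣≤∣p─q∣+∣q∣ : ∀ (p q : Subset n) → ∣ p ∣ ≤ ∣ p ─ q ∣ + ∣ q ∣
∣p∣≤∣p─q∣+∣q∣ p q = begin
  ∣ p ∣                 ≡⟨ ∣p─q∣+∣p∩q∣≡∣p∣ p q ⟨
  ∣ p ─ q ∣ + ∣ p ∩ q ∣ ≤⟨ +-monoʳ-≤ ∣ p ─ q ∣ (∣p∩q∣≤∣q∣ p q) ⟩
  ∣ p ─ q ∣ + ∣ q ∣     ∎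
  where open ≤-Reasoning

∣p─q∣+∣q∣≤∣p∣ : ∀ {p q : Subset n} → q ⊆ p → ∣ p ─ q ∣ + ∣ q ∣ ≤ ∣ p ∣
∣p─q∣+∣q∣≤∣p∣ {p = p} {q} q⊆p = begin
  ∣ p ─ q ∣ + ∣ q ∣     ≤⟨ +-monoʳ-≤ ∣ p ─ q ∣ (p⊆q⇒∣p∣≤∣q∣ (λ x∈q → x∈p∩q⁺ (q⊆p x∈q , x∈q))) ⟩
  ∣ p ─ q ∣ + ∣ p ∩ q ∣ ≡⟨ ∣p─q∣+∣p∩q∣≡∣p∣ p q ⟩
  ∣ p ∣                 ∎
  where open ≤-Reasoning

∣p∣∸∣q∣≤∣p─q∣ : ∀ (p q : Subset n) → ∣ p ∣ ∸ ∣ q ∣ ≤ ∣ p ─ q ∣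
∣p∣∸∣q∣≤∣p─q∣ p q =
  m≤n+o⇒m∸n≤o ∣ p ∣ ∣ q ∣ (subst (∣ p ∣ ≤_) (+-comm ∣ p ─ q ∣ ∣ q ∣) (∣p∣≤∣p─q∣+∣q∣ p q))

∣p─q∣≤∣p∣∸∣q∣ : ∀ {p q : Subset n} → q ⊆ p → ∣ p ─ q ∣ ≤ ∣ p ∣ ∸ ∣ q ∣
∣p─q∣≤∣p∣∸∣q∣ q⊆p = m+n≤o⇒m≤o∸n _ (∣p─q∣+∣q∣≤∣p∣ q⊆p)

p⊆q∪r⇒∣p∣≤∣q∣+∣r∣ : ∀ {p q r : Subset n} → p ⊆ q ∪ r → ∣ p ∣ ≤ ∣ q ∣ + ∣ r ∣
p⊆q∪r⇒∣p∣≤∣q∣+∣r∣ {p = p} {q} {r} p⊆q∪r =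
  ≤-trans (∣p∣≤∣p─q∣+∣q∣ p r) (+-monoˡ-≤ ∣ r ∣ (p⊆q⇒∣p∣≤∣q∣ p─r⊆q))
  where
  p─r⊆q : p ─ r ⊆ q
  p─r⊆q x∈ with x∈p─q⁻ p r x∈
  ... | x∈p , x∉r with x∈p∪q⁻ q r (p⊆q∪r x∈p)
  ...   | inj₁ x∈q = x∈q
  ...   | inj₂ x∈r = contradiction x∈r x∉r

∣p∣<∣p∪⁅x⁆∣ : ∀ {p : Subset n} {x} → x ∉ p → ∣ p ∣ < ∣ p ∪ ⁅ x ⁆ ∣
∣p∣<∣p∪⁅x⁆∣ {p = p} {x} x∉p = p⊂q⇒∣p∣<∣q∣ (p⊆p∪q ⁅ x ⁆ , x , q⊆p∪q p ⁅ x ⁆ (x∈⁅x⁆ x) , x∉p)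

∣p∣≤1+∣p-x∣ : ∀ (p : Subset n) x → ∣ p ∣ ≤ suc ∣ p - x ∣
∣p∣≤1+∣p-x∣ p x = begin
  ∣ p ∣                 ≤⟨ ∣p∣≤∣p─q∣+∣q∣ p ⁅ x ⁆ ⟩
  ∣ p - x ∣ + ∣ ⁅ x ⁆ ∣ ≡⟨ cong (∣ p - x ∣ +_) (∣⁅x⁆∣≡1 x) ⟩
  ∣ p - x ∣ + 1         ≡⟨ +-comm ∣ p - x ∣ 1 ⟩
  suc ∣ p - x ∣         ∎
  where open ≤-Reasoning

∣p∣>0⇒Nonempty : ∀ (p : Subset n) → 0 < ∣ p ∣ → Nonempty p
∣p∣>0⇒Nonempty {n} p 0<∣p∣ with nonempty? p
... | yes ne = ne
... | no ¬ne = contradiction (trans (cong ∣_∣ (Empty-unique ¬ne)) (∣⊥∣≡0 n)) (≢-sym (<⇒≢ 0<∣p∣))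

∣p++q∣≡∣p∣+∣q∣ : ∀ (p : Subset m) (q : Subset n) → ∣ p ++ q ∣ ≡ ∣ p ∣ + ∣ q ∣
∣p++q∣≡∣p∣+∣q∣ []            q = refl
∣p++q∣≡∣p∣+∣q∣ (inside ∷ p)  q = cong suc (∣p++q∣≡∣p∣+∣q∣ p q)
∣p++q∣≡∣p∣+∣q∣ (outside ∷ p) q = ∣p++q∣≡∣p∣+∣q∣ p q

-- Fin (m + n) as a disjoint union

data Split (m n : ℕ) : Fin (m + n) → Set where
  left  : ∀ x → Split m n (x ↑ˡ n)
  right : ∀ y → Split m n (m ↑ʳ y)

split : ∀ m {n} (a : Fin (m + n)) → Split m n a
split m {n} a with splitAt m a in eq
... | inj₁ x = subst (Split m n) (Fin.splitAt⁻¹-↑ˡ eq) (left x)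
... | inj₂ y = subst (Split m n) (Fin.splitAt⁻¹-↑ʳ eq) (right y)

↑ˡ≢↑ʳ : ∀ (x : Fin m) (y : Fin n) → x ↑ˡ n ≢ m ↑ʳ y
↑ˡ≢↑ʳ {m} {n} x y eq = inj₁≢inj₂ (begin
  inj₁ x                 ≡⟨ Fin.splitAt-↑ˡ m x n ⟨
  splitAt m (x ↑ˡ n)     ≡⟨ cong (splitAt m) eq ⟩
  splitAt m (m ↑ʳ y)     ≡⟨ Fin.splitAt-↑ʳ m n y ⟩
  inj₂ y                 ∎)
  where
  open ≡-Reasoning
  inj₁≢inj₂ : inj₁ x ≢ inj₂ y
  inj₁≢inj₂ ()

∈-++⁺ˡ : ∀ {p : Subset m} {q : Subset n} {x} → x ∈ p → x ↑ˡ n ∈ p ++ q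
∈-++⁺ˡ {p = p} {q} {x} x∈ = lookup⇒[]= _ (p ++ q) (trans (lookup-++ˡ p q x) ([]=⇒lookup x∈))

∈-++⁻ˡ : ∀ (p : Subset m) {q : Subset n} {x} → x ↑ˡ n ∈ p ++ q → x ∈ p
∈-++⁻ˡ p {q} {x} x∈ = lookup⇒[]= x p (trans (sym (lookup-++ˡ p q x)) ([]=⇒lookup x∈))

∈-++⁺ʳ : ∀ (p : Subset m) {q : Subset n} {y} → y ∈ q → m ↑ʳ y ∈ p ++ q
∈-++⁺ʳ p {q} {y} y∈ = lookup⇒[]= _ (p ++ q) (trans (lookup-++ʳ p q y) ([]=⇒lookup y∈))

∈-++⁻ʳ : ∀ (p : Subset m) {q : Subset n} {y} → m ↑ʳ y ∈ p ++ q → y ∈ q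
∈-++⁻ʳ p {q} {y} y∈ = lookup⇒[]= y q (trans (sym (lookup-++ʳ p q y)) ([]=⇒lookup y∈))

module _ (A : Subset (m + n)) where

  private
    A≡ : take m A ++ drop m A ≡ A
    A≡ = take++drop≡id m A

  ∈-take⁺ : ∀ {x} → x ↑ˡ n ∈ A → x ∈ take m A
  ∈-take⁺ x∈ = ∈-++⁻ˡ (take m A) (subst (_ ∈_) (sym A≡) x∈)

  ∈-take⁻ : ∀ {x} → x ∈ take m A → x ↑ˡ n ∈ A
  ∈-take⁻ x∈ = subst (_ ∈_) A≡ (∈-++⁺ˡ x∈)

  ∈-drop⁺ : ∀ {y} → m ↑ʳ y ∈ A → y ∈ drop m A
  ∈-drop⁺ y∈ = ∈-++⁻ʳ (take m A) (subst (_ ∈_) (sym A≡) y∈)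

  ∈-drop⁻ : ∀ {y} → y ∈ drop m A → m ↑ʳ y ∈ A
  ∈-drop⁻ y∈ = subst (_ ∈_) A≡ (∈-++⁺ʳ (take m A) y∈)

  ∣A∣≡∣take∣+∣drop∣ : ∣ A ∣ ≡ ∣ take m A ∣ + ∣ drop m A ∣
  ∣A∣≡∣take∣+∣drop∣ = trans (cong ∣_∣ (sym A≡)) (∣p++q∣≡∣p∣+∣q∣ (take m A) (drop m A))

  A⊆take++drop─Y∪⊥++Y : ∀ Y → A ⊆ (take m A ++ (drop m A ─ Y)) ∪ (⊥ ++ Y)
  A⊆take++drop─Y∪⊥++Y Y {a} a∈ with split m a
  ... | left x = x∈p∪q⁺ (inj₁ (∈-++⁺ˡ (∈-take⁺ a∈)))
  ... | right y with y ∈? Y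
  ...   | yes y∈Y = x∈p∪q⁺ (inj₂ (∈-++⁺ʳ ⊥ y∈Y))
  ...   | no y∉Y  = x∈p∪q⁺ (inj₁ (∈-++⁺ʳ (take m A) (x∈p∧x∉q⇒x∈p─q (∈-drop⁺ a∈) y∉Y)))

Assignment : Subset n → ℕ → Set
Assignment {n} A k = (a : Fin n) → a ∈ A → Fin k

InjectiveOn : (A : Subset n) → Assignment A k → Set
InjectiveOn A f = ∀ a b (a∈ : a ∈ A) (b∈ : b ∈ A) → f a a∈ ≡ f b b∈ → a ≡ b

Injection : Subset m → Subset n → Set
Injection {n = n} p q = Σ (Assignment p n) λ h → InjectiveOn p h × (∀ x x∈ → h x x∈ ∈ q)

Injection⇒∣p∣≤∣q∣ : ∀ {p : Subset m} {q : Subset n} → Injection p q → ∣ p ∣ ≤ ∣ q ∣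
Injection⇒∣p∣≤∣q∣ {p = []} _ = z≤n
Injection⇒∣p∣≤∣q∣ {p = outside ∷ p} (h , h-inj , h∈) = Injection⇒∣p∣≤∣q∣ {p = p}
  ((λ x x∈ → h (suc x) (there x∈)) , (λ x y _ _ → Fin.suc-injective ∘ h-inj _ _ _ _) , λ _ _ → h∈ _ _)
Injection⇒∣p∣≤∣q∣ {p = inside ∷ p} {q} (h , h-inj , h∈) =
  ≤-trans (s≤s (Injection⇒∣p∣≤∣q∣ {p = p} tail)) (x∈p⇒∣p-x∣<∣p∣ (h∈ zero here))
  where
  tail : Injection p (q - h zero here)
  tail = (λ x x∈ → h (suc x) (there x∈)) , (λ x y _ _ → Fin.suc-injective ∘ h-inj _ _ _ _) ,
         λ x x∈ → x∈p∧x≢y⇒x∈p-y (h∈ _ _) (λ eq → Fin.0≢1+n (h-inj _ _ _ _ (sym eq)))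

∣p∣≤∣q∣⇒Injection : ∀ (p : Subset m) (q : Subset n) → ∣ p ∣ ≤ ∣ q ∣ → Injection p q
∣p∣≤∣q∣⇒Injection []            q _ = (λ _ ()) , (λ _ _ ()) , λ _ ()
∣p∣≤∣q∣⇒Injection (outside ∷ p) q ∣p∣≤∣q∣ with ∣p∣≤∣q∣⇒Injection p q ∣p∣≤∣q∣
... | h , h-inj , h∈ = h′ , h′-inj , h′∈
  where
  h′ : Assignment (outside ∷ p) _
  h′ (suc x) (there x∈) = h x x∈
  h′-inj : InjectiveOn (outside ∷ p) h′
  h′-inj (suc x) (suc y) (there x∈) (there y∈) = cong suc ∘ h-inj x y x∈ y∈
  h′∈ : ∀ x x∈ → h′ x x∈ ∈ q
  h′∈ (suc x) (there x∈) = h∈ x x∈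
∣p∣≤∣q∣⇒Injection (inside ∷ p) q 1+∣p∣≤∣q∣ with ∣p∣>0⇒Nonempty q (≤-trans (s≤s z≤n) 1+∣p∣≤∣q∣)
... | y , y∈q with ∣p∣≤∣q∣⇒Injection p (q - y) (s≤s⁻¹ (≤-trans 1+∣p∣≤∣q∣ (∣p∣≤1+∣p-x∣ q y)))
... | h , h-inj , h∈ = h′ , h′-inj , h′∈
  where
  h′ : Assignment (inside ∷ p) _
  h′ zero here = y
  h′ (suc x) (there x∈) = h x x∈
  h′-inj : InjectiveOn (inside ∷ p) h′
  h′-inj zero    zero    here       here       _  = refl
  h′-inj zero    (suc x) here       (there x∈) eq = contradiction (sym eq) (x∈p-y⇒x≢y (h∈ x x∈))
  h′-inj (suc x) zero    (there x∈) here       eq = contradiction eq (x∈p-y⇒x≢y (h∈ x x∈))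
  h′-inj (suc x) (suc y) (there x∈) (there y∈) eq = cong suc (h-inj x y x∈ y∈ eq)
  h′∈ : ∀ x x∈ → h′ x x∈ ∈ q
  h′∈ zero    here       = y∈q
  h′∈ (suc x) (there x∈) = p─q⊆p q ⁅ y ⁆ (h∈ x x∈)

Hits : {A : Subset n} → Assignment A k → Fin k → Set
Hits {A = A} f i = ∃ λ a → Σ (a ∈ A) λ a∈ → f a a∈ ≡ i

hits? : {A : Subset n} (f : Assignment A k) → Decidable (Hits f)
hits? f i = Fin.any? (λ a → ∃∈? (λ a∈ → f a a∈ Fin.≟ i))

image : {A : Subset n} → Assignment A k → Subset k
image f = subset (hits? f)

f∈image : ∀ {A : Subset n} (f : Assignment A k) a a∈ → f a a∈ ∈ image f
f∈image f a a∈ = ∈-subset⁺ (hits? f) (a , a∈ , refl)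

image⁻ : ∀ {A : Subset n} (f : Assignment A k) {i} → i ∈ image f → Hits f i
image⁻ f = ∈-subset⁻ (hits? f)

∣image∣≡∣dom∣ : ∀ {A : Subset n} (f : Assignment A k) → InjectiveOn A f → ∣ image f ∣ ≡ ∣ A ∣
∣image∣≡∣dom∣ {n = n} f f-inj = ≤-antisym
  (Injection⇒∣p∣≤∣q∣ (inverse , inverse-inj , λ i i∈ → proj₁ (proj₂ (image⁻ f i∈))))
  (Injection⇒∣p∣≤∣q∣ (f , f-inj , f∈image f))
  where
  inverse : Assignment (image f) n
  inverse i i∈ = proj₁ (image⁻ f i∈)
  inverse-inj : InjectiveOn (image f) inverse
  inverse-inj i j i∈ j∈ eq with image⁻ f i∈ | image⁻ f j∈
  ... | a , a∈ , refl | b , b∈ , refl with refl ← eq = cong (f a) ([]=-irrelevant a∈ b∈)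

∣p∣∸∣A∣≤∣p─image∣ : ∀ (p : Subset k) {A : Subset n} (f : Assignment A k) → InjectiveOn A f →
                    ∣ p ∣ ∸ ∣ A ∣ ≤ ∣ p ─ image f ∣
∣p∣∸∣A∣≤∣p─image∣ p f f-inj =
  subst (λ c → ∣ p ∣ ∸ c ≤ ∣ p ─ image f ∣) (∣image∣≡∣dom∣ f f-inj) (∣p∣∸∣q∣≤∣p─q∣ p (image f))

-- Partial transversals as matchings

record Matching (F : Fin k → Subset n) (A : Subset n) : Set where
  constructor matching
  field
    slot           : Assignment A k
    slot-injective : InjectiveOn A slot
    ∈slot          : ∀ a a∈ → a ∈ F (slot a a∈)
open Matching

PT⇔Matching : ∀ {F : Fin k → Subset n} {A} → IsPartialTransversal F A ⇔ Matching F A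
PT⇔Matching = mk⇔ (λ (f , f-inj , f∈) → matching f f-inj f∈) λ (matching f f-inj f∈) → f , f-inj , f∈

matching-⊥ : ∀ {F : Fin k → Subset n} → Matching F ⊥
matching-⊥ = matching (λ _ x∈ → contradiction x∈ ∉⊥) (λ _ _ x∈ → contradiction x∈ ∉⊥)
                      (λ _ x∈ → contradiction x∈ ∉⊥)

matching-⊆ : ∀ {F : Fin k → Subset n} {A A′} → A′ ⊆ A → Matching F A → Matching F A′
matching-⊆ A′⊆A (matching f f-inj f∈) =
  matching (λ a a∈ → f a (A′⊆A a∈)) (λ a b _ _ → f-inj a b _ _) (λ a _ → f∈ a _)

matching-reslot : ∀ {F : Fin k → Subset n} {G : Fin l → Subset n} {A} (σ : Fin k → Fin l) →
                  (∀ {s t} → σ s ≡ σ t → s ≡ t) → (∀ {s a} → a ∈ F s → a ∈ G (σ s)) →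
                  Matching F A → Matching G A
matching-reslot σ σ-inj F⇒G (matching f f-inj f∈) =
  matching (λ a a∈ → σ (f a a∈)) (λ a b a∈ b∈ → f-inj a b a∈ b∈ ∘ σ-inj) (λ a a∈ → F⇒G (f∈ a a∈))

matching-mono : ∀ {F G : Fin k → Subset n} {A} → (∀ {s a} → a ∈ F s → a ∈ G s) →
                Matching F A → Matching G A
matching-mono = matching-reslot id id

matching-extend : ∀ {F : Fin k → Subset n} {A x} (μ : Matching F A) i → x ∈ F i →
                  (∀ a a∈ → slot μ a a∈ ≢ i) → Matching F (A ∪ ⁅ x ⁆)
matching-extend {F = F} {A} {x} (matching f f-inj f∈) i x∈Fi avoids-i = matching h h-inj h∈
  where
  h : Assignment (A ∪ ⁅ x ⁆) _
  h a a∈ with a Fin.≟ x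
  ... | yes _   = i
  ... | no a≢x = f a (p∪⁅x⁆-x⊆p A x (x∈p∧x≢y⇒x∈p-y a∈ a≢x))
  h-inj : InjectiveOn (A ∪ ⁅ x ⁆) h
  h-inj a b a∈ b∈ eq with a Fin.≟ x | b Fin.≟ x
  ... | yes a≡x | yes b≡x = trans a≡x (sym b≡x)
  ... | yes _   | no _    = contradiction (sym eq) (avoids-i b _)
  ... | no _    | yes _   = contradiction eq (avoids-i a _)
  ... | no _    | no _    = f-inj a b _ _ eq
  h∈ : ∀ a a∈ → a ∈ F (h a a∈)
  h∈ a a∈ with a Fin.≟ x
  ... | yes refl = x∈Fi
  ... | no _     = f∈ a _

matching-avoid : ∀ {F : Fin (suc k) → Subset n} {A} i (μ : Matching F A) → (∀ a a∈ → slot μ a a∈ ≢ i) →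
                 Matching (F ∘ punchIn i) A
matching-avoid {F = F} i (matching f f-inj f∈) avoids-i = matching
  (λ a a∈ → punchOut (≢-sym (avoids-i a a∈)))
  (λ a b a∈ b∈ → f-inj a b a∈ b∈ ∘ Fin.punchOut-injective (≢-sym (avoids-i a a∈)) (≢-sym (avoids-i b b∈)))
  (λ a a∈ → subst (λ s → a ∈ F s) (sym (Fin.punchIn-punchOut _)) (f∈ a a∈))

matching-cons : ∀ {F : Fin (suc k) → Subset n} {A} →
                (∃ λ a → a ∈ A × a ∈ F zero × Matching (F ∘ suc) (A - a)) → Matching F A
matching-cons {A = A} (a , a∈A , a∈F₀ , μ) =
  matching-⊆ (p⊆p-x∪⁅x⁆ A a)
    (matching-extend (matching-reslot suc Fin.suc-injective id μ) zero a∈F₀ (λ _ _ ()))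

matching-uncons : ∀ {F : Fin (suc k) → Subset n} {A} → Matching F A →
                  Matching (F ∘ suc) A ⊎ ∃ λ a → a ∈ A × a ∈ F zero × Matching (F ∘ suc) (A - a)
matching-uncons {F = F} {A} μ@(matching f f-inj f∈) with zero ∈? image f
... | no 0∉ = inj₁ (matching-avoid zero μ λ a a∈ fa≡0 → 0∉ (subst (_∈ image f) fa≡0 (f∈image f a a∈)))
... | yes 0∈ with image⁻ f 0∈
...   | a , a∈ , fa≡0 = inj₂ (a , a∈ , subst (λ s → a ∈ F s) fa≡0 (f∈ a a∈) ,
          matching-avoid zero (matching-⊆ (p─q⊆p A ⁅ a ⁆) μ) λ b b∈ fb≡0 →
            x∈p-y⇒x≢y b∈ (f-inj b a _ a∈ (trans fb≡0 (sym fa≡0))))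

matchable? : ∀ (F : Fin k → Subset n) A → Dec (Matching F A)
matchable? {zero} F A with nonempty? A
... | yes (a , a∈) = no λ μ → Fin.¬Fin0 (slot μ a a∈)
... | no empty     = yes (subst (Matching F) (sym (Empty-unique empty)) matching-⊥)
matchable? {suc k} F A =
  map′ [ matching-reslot suc Fin.suc-injective id , matching-cons ] matching-uncons
    (matchable? (F ∘ suc) A ⊎-dec
     Fin.any? (λ a → a ∈? A ×-dec a ∈? F zero ×-dec matchable? (F ∘ suc) (A - a)))

-- Opaque, so that the family and the slots can be inferred from membership proofs.
opaque
  _↾_ : (Fin k → Subset n) → Subset k → Fin k → Subset n
  (F ↾ I) i = if lookup I i then F i else ⊥

  ∈↾⁺ : ∀ {F : Fin k → Subset n} {I i a} → i ∈ I → a ∈ F i → a ∈ (F ↾ I) i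
  ∈↾⁺ i∈I a∈ rewrite []=⇒lookup i∈I = a∈

  ∈↾⁻ : ∀ {F : Fin k → Subset n} {I i a} → a ∈ (F ↾ I) i → i ∈ I × a ∈ F i
  ∈↾⁻ {I = I} {i} a∈ with lookup I i in eq
  ... | inside  = lookup⇒[]= i I eq , a∈
  ... | outside = contradiction a∈ ∉⊥

  contract : (Fin k → Subset n) → Fin n → Fin k → Fin k → Subset n
  contract F x i = (λ s → F s - x) ↾ (⊤ - i)

  ∈contract⁺ : ∀ {F : Fin k → Subset n} {x i s a} → a ∈ F s → a ≢ x → s ≢ i → a ∈ contract F x i s
  ∈contract⁺ {F = F} {x} a∈ a≢x s≢i =
    ∈↾⁺ {F = λ s → F s - x} (x∈p∧x≢y⇒x∈p-y ∈⊤ s≢i) (x∈p∧x≢y⇒x∈p-y a∈ a≢x)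

  ∈contract⁻ : ∀ {F : Fin k → Subset n} {x i s a} → a ∈ contract F x i s → a ∈ F s × a ≢ x × s ≢ i
  ∈contract⁻ {F = F} {x} {i} {s} a∈ with ∈↾⁻ {F = λ s → F s - x} {I = ⊤ - i} a∈
  ... | s∈ , a∈′ = p─q⊆p (F s) ⁅ x ⁆ a∈′ , x∈p-y⇒x≢y a∈′ , x∈p-y⇒x≢y {p = ⊤} s∈

matching-contract : ∀ {F : Fin k → Subset n} {A x} (μ : Matching F A) i →
                    (∀ a a∈ → a ≢ x → slot μ a a∈ ≢ i) → Matching (contract F x i) (A - x)
matching-contract {A = A} {x} (matching f f-inj f∈) i avoids-i = matching
  (λ a a∈ → f a (p─q⊆p A ⁅ x ⁆ a∈)) (λ a b _ _ → f-inj a b _ _)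
  (λ a a∈ → ∈contract⁺ (f∈ a _) (x∈p-y⇒x≢y a∈) (avoids-i a _ (x∈p-y⇒x≢y a∈)))

-- Slots of a maximum partial transversal

Maximum : (Fin k → Subset n) → Subset n → Set
Maximum F B = ∀ Z → Matching F Z → ∣ Z ∣ ≤ ∣ B ∣

contract-maximum : ∀ {F : Fin k → Subset n} {B x i} → Maximum F B → x ∈ F i →
                   Maximum (contract F x i) (B - x)
contract-maximum {F = F} {B} {x} {i} maximum x∈Fi Z (matching e e-inj e∈) = s≤s⁻¹ (begin
  suc ∣ Z ∣     ≤⟨ ∣p∣<∣p∪⁅x⁆∣ (λ x∈Z → proj₁ (proj₂ (∈contract⁻ (e∈ x x∈Z))) refl) ⟩
  ∣ Z ∪ ⁅ x ⁆ ∣ ≤⟨ maximum _ (matching-extend e′ i x∈Fi avoids-i) ⟩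
  ∣ B ∣         ≤⟨ ∣p∣≤1+∣p-x∣ B x ⟩
  suc ∣ B - x ∣ ∎)
  where
  open ≤-Reasoning
  e′ : Matching F Z
  e′ = matching-mono (proj₁ ∘ ∈contract⁻) (matching e e-inj e∈)
  avoids-i : ∀ z z∈ → e z z∈ ≢ i
  avoids-i z z∈ = proj₂ (proj₂ (∈contract⁻ (e∈ z z∈)))

unused-slot⇒∈B : ∀ {F : Fin k → Subset n} {B x} i → Maximum F B → (g : Matching F B) → x ∈ F i →
                 i ∉ image (slot g) → x ∈ B
unused-slot⇒∈B {B = B} {x} i maximum g x∈Fi i∉Ig with x ∈? B
... | yes x∈B = x∈B
... | no x∉B  = contradiction (maximum _ (matching-extend g i x∈Fi avoids-i)) (<⇒≱ (∣p∣<∣p∪⁅x⁆∣ x∉B))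
  where
  avoids-i : ∀ b b∈ → slot g b b∈ ≢ i
  avoids-i b b∈ eq = i∉Ig (subst (_∈ image (slot g)) eq (f∈image (slot g) b b∈))

Restrictable : (Fin k → Subset n) → Subset n → Set
Restrictable F B = (g : Matching F B) → ∀ {X} → Matching F X → Matching (F ↾ image (slot g)) X

rematch-by-contraction :
  ∀ {F : Fin k → Subset n} {B X x₀} → Maximum F B →
  (∀ {F′ : Fin k → Subset n} {B′} → ∣ B′ ∣ < ∣ B ∣ → Maximum F′ B′ → Restrictable F′ B′) →
  (g : Matching F B) (f : Matching F X) (x₀∈X : x₀ ∈ X) → slot f x₀ x₀∈X ∉ image (slot g) →
  Matching (F ↾ image (slot g)) X
rematch-by-contraction {k = k} {n = n} {F = F} {B} {X} {x₀} maximum IH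
  g@(matching g₀ g-inj g∈) f@(matching f₀ f-inj f∈) x₀∈X i₀∉Ig =
  matching-⊆ (p⊆p-x∪⁅x⁆ X x₀)
    (matching-extend lifted j (∈↾⁺ (f∈image g₀ x₀ x₀∈B) (g∈ x₀ x₀∈B)) avoids-j)
  where
  i₀ : Fin k
  i₀ = f₀ x₀ x₀∈X
  x₀∈B : x₀ ∈ B
  x₀∈B = unused-slot⇒∈B i₀ maximum g (f∈ x₀ x₀∈X) i₀∉Ig
  j : Fin k
  j = g₀ x₀ x₀∈B
  F′ : Fin k → Subset n
  F′ = contract F x₀ i₀
  g′ : Matching F′ (B - x₀)
  g′ = matching-contract g i₀ λ b b∈ _ eq → i₀∉Ig (subst (_∈ image g₀) eq (f∈image g₀ b b∈))
  f′ : Matching F′ (X - x₀)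
  f′ = matching-contract f i₀ λ x x∈ x≢x₀ eq → x≢x₀ (f-inj _ _ _ _ eq)
  Ig′⊆Ig-j : image (slot g′) ⊆ image g₀ - j
  Ig′⊆Ig-j s∈ with image⁻ (slot g′) s∈
  ... | b , b∈ , refl = x∈p∧x≢y⇒x∈p-y (f∈image g₀ b _) (λ eq → x∈p-y⇒x≢y b∈ (g-inj _ _ _ _ eq))
  restricted : Matching (F′ ↾ image (slot g′)) (X - x₀)
  restricted = IH {B′ = B - x₀} (x∈p⇒∣p-x∣<∣p∣ x₀∈B)
                  (contract-maximum {B = B} {i = i₀} maximum (f∈ x₀ x₀∈X)) g′ f′
  lift : ∀ {s a} → a ∈ (F′ ↾ image (slot g′)) s → a ∈ (F ↾ image g₀) s
  lift a∈ with ∈↾⁻ a∈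
  ... | s∈ , a∈F′ = ∈↾⁺ (p─q⊆p _ _ (Ig′⊆Ig-j s∈)) (proj₁ (∈contract⁻ a∈F′))
  lifted : Matching (F ↾ image g₀) (X - x₀)
  lifted = matching-mono lift restricted
  avoids-j : ∀ x x∈ → slot lifted x x∈ ≢ j
  avoids-j x x∈ = x∈p-y⇒x≢y (Ig′⊆Ig-j (proj₁ (∈↾⁻ (∈slot restricted x x∈))))

restrict-step : ∀ {F : Fin k → Subset n} {B} → Maximum F B →
                (∀ {F′ : Fin k → Subset n} {B′} → ∣ B′ ∣ < ∣ B ∣ → Maximum F′ B′ → Restrictable F′ B′) →
                Restrictable F B
restrict-step maximum IH g f with nonempty? (image (slot f) ─ image (slot g))
... | yes (i₀ , i₀∈) with x∈p─q⁻ (image (slot f)) (image (slot g)) i₀∈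
...   | i₀∈If , i₀∉Ig with image⁻ (slot f) i₀∈If
...     | x₀ , x₀∈X , refl = rematch-by-contraction maximum IH g f x₀∈X i₀∉Ig
restrict-step maximum IH g (matching f f-inj f∈) | no none =
  matching f f-inj λ a a∈ → ∈↾⁺ (slot∈Ig a a∈) (f∈ a a∈)
  where
  slot∈Ig : ∀ a a∈ → f a a∈ ∈ image (slot g)
  slot∈Ig a a∈ with f a a∈ ∈? image (slot g)
  ... | yes ∈Ig = ∈Ig
  ... | no ∉Ig  = contradiction (f a a∈ , x∈p∧x∉q⇒x∈p─q (f∈image f a a∈) ∉Ig) none

maximum⇒restrictable : ∀ {F : Fin k → Subset n} {B} → Maximum F B → Restrictable F B
maximum⇒restrictable = bounded _ ≤-refl
  where
  bounded : ∀ r {F : Fin k → Subset n} {B} → ∣ B ∣ ≤ r → Maximum F B → Restrictable F B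
  bounded zero    ∣B∣≤0 maximum = restrict-step maximum λ lt → contradiction (≤-trans lt ∣B∣≤0) λ ()
  bounded (suc r) ∣B∣≤r maximum = restrict-step maximum λ lt → bounded r (s≤s⁻¹ (≤-trans lt ∣B∣≤r))

rank-exists : ∀ (M : Matroid n) → Decidable (Indep M) → ∀ X → ∃ (IsRank M X)
rank-exists {n} M indep? X = search n (λ B _ _ → ∣p∣≤n B)
  where
  search : ∀ c → (∀ B → B ⊆ X → Indep M B → ∣ B ∣ ≤ c) → ∃ (IsRank M X)
  search c bound with anySubset? (λ B → B ⊆? X ×-dec indep? B ×-dec ∣ B ∣ ≟ c)
  ... | yes witness = c , witness , bound
  search zero    bound | no _ = 0 , (⊥ , ⊥⊆ , indep-∅ M , ∣⊥∣≡0 n) , bound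
  search (suc c) bound | no none = search c λ B B⊆X B-indep →
    s≤s⁻¹ (≤∧≢⇒< (bound B B⊆X B-indep) λ ∣B∣≡1+c → none (B , B⊆X , B-indep , ∣B∣≡1+c))

rank-unique : ∀ {M : Matroid n} {X r r′} → IsRank M X r → IsRank M X r′ → r ≡ r′
rank-unique ((B , B⊆X , B-indep , refl) , bound) ((B′ , B′⊆X , B′-indep , refl) , bound′) =
  ≤-antisym (bound′ B B⊆X B-indep) (bound B′ B′⊆X B′-indep)

indep⇒IsRank : ∀ {M : Matroid n} {X} → Indep M X → IsRank M X ∣ X ∣
indep⇒IsRank X-indep = (_ , id , X-indep , refl) , λ _ B⊆X _ → p⊆q⇒∣p∣≤∣q∣ B⊆X

Presents : (Subset n → Set) → (Fin k → Subset n) → Set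
Presents Ind F = ∀ A → Ind A ⇔ Matching F A

indep? : ∀ (M : Matroid n) {F : Fin k → Subset n} → Presents (Indep M) F → Decidable (Indep M)
indep? M {F} presents A =
  map′ (Equivalence.from (presents A)) (Equivalence.to (presents A)) (matchable? F A)

rank-sized-presentation : ∀ {M : Matroid n} {F : Fin k → Subset n} → Presents (Indep M) F →
                          Σ (Subset k) λ I → Presents (Indep M) (F ↾ I) × IsRank M ⊤ ∣ I ∣
rank-sized-presentation {M = M} {F} presents with rank-exists M (indep? M presents) ⊤
... | r , (B , B⊆⊤ , B-indep , ∣B∣≡r) , bound = image (slot g) , presents↾ , rank
  where
  g : Matching F B
  g = Equivalence.to (presents B) B-indep
  maximum : Maximum F B
  maximum Z μ = subst (∣ Z ∣ ≤_) (sym ∣B∣≡r) (bound Z ⊆⊤ (Equivalence.from (presents Z) μ))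
  presents↾ : Presents (Indep M) (F ↾ image (slot g))
  presents↾ A = mk⇔ (maximum⇒restrictable maximum g ∘ Equivalence.to (presents A))
                    (Equivalence.from (presents A) ∘ matching-mono (proj₂ ∘ ∈↾⁻))
  rank : IsRank M ⊤ ∣ image (slot g) ∣
  rank = subst (IsRank M ⊤) (sym (trans (∣image∣≡∣dom∣ (slot g) (slot-injective g)) ∣B∣≡r))
               ((B , B⊆⊤ , B-indep , ∣B∣≡r) , bound)

-- The free product

matching-∪ : ∀ {G : Fin k → Subset n} {P Q} (μ₁ : Matching G P) (μ₂ : Matching G Q) →
             (∀ a a∈ b b∈ → slot μ₁ a a∈ ≢ slot μ₂ b b∈) → Matching G (P ∪ Q)
matching-∪ {G = G} {P} {Q} (matching f f-inj f∈) (matching f′ f′-inj f′∈) disjoint = matching h h-inj h∈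
  where
  in-Q : ∀ {a} → a ∈ P ∪ Q → a ∉ P → a ∈ Q
  in-Q a∈ a∉P with x∈p∪q⁻ P Q a∈
  ... | inj₁ a∈P = contradiction a∈P a∉P
  ... | inj₂ a∈Q = a∈Q
  h : Assignment (P ∪ Q) _
  h a a∈ with a ∈? P
  ... | yes a∈P = f a a∈P
  ... | no a∉P  = f′ a (in-Q a∈ a∉P)
  h-inj : InjectiveOn (P ∪ Q) h
  h-inj a b a∈ b∈ eq with a ∈? P | b ∈? P
  ... | yes _ | yes _ = f-inj a b _ _ eq
  ... | yes _ | no _  = contradiction eq (disjoint a _ b _)
  ... | no _  | yes _ = contradiction (sym eq) (disjoint b _ a _)
  ... | no _  | no _  = f′-inj a b _ _ eq
  h∈ : ∀ a a∈ → a ∈ G (h a a∈)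
  h∈ a a∈ with a ∈? P
  ... | yes _ = f∈ a _
  ... | no _  = f′∈ a _

RoutedThrough : {A : Subset n} → Assignment A k → (Fin l → Fin k) → Fin n → Set
RoutedThrough {A = A} f σ a = Σ (a ∈ A) λ a∈ → ∃ λ i → f a a∈ ≡ σ i

routedThrough? : {A : Subset n} (f : Assignment A k) (σ : Fin l → Fin k) → Decidable (RoutedThrough f σ)
routedThrough? f σ a = ∃∈? λ a∈ → Fin.any? λ i → f a a∈ Fin.≟ σ i

preimage : {A : Subset n} → Assignment A k → (Fin l → Fin k) → Subset n
preimage f σ = subset (routedThrough? f σ)

preimage⊆ : ∀ {A : Subset n} (f : Assignment A k) (σ : Fin l → Fin k) → preimage f σ ⊆ A
preimage⊆ f σ = proj₁ ∘ ∈-subset⁻ (routedThrough? f σ)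

matching-preimage : ∀ {G : Fin k → Subset n} {F : Fin l → Subset n} {A}
                    (μ : Matching G A) (σ : Fin l → Fin k) → (∀ {i a} → a ∈ G (σ i) → a ∈ F i) →
                    Matching F (preimage (slot μ) σ)
matching-preimage {G = G} {F} (matching f f-inj f∈) σ G⇒F = matching h h-inj h∈
  where
  through : ∀ {a} → a ∈ preimage f σ → RoutedThrough f σ a
  through = ∈-subset⁻ (routedThrough? f σ)
  h : Assignment (preimage f σ) _
  h a a∈ = proj₁ (proj₂ (through a∈))
  h-inj : InjectiveOn (preimage f σ) h
  h-inj a b a∈ b∈ eq with through a∈ | through b∈
  ... | a∈A , _ , fa≡σi | b∈A , _ , fb≡σj =
    f-inj a b a∈A b∈A (trans fa≡σi (trans (cong σ eq) (sym fb≡σj)))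
  h∈ : ∀ a a∈ → a ∈ F (h a a∈)
  h∈ a a∈ with through a∈
  ... | a∈A , _ , fa≡σi = G⇒F (subst (λ s → a ∈ G s) fa≡σi (f∈ a a∈A))

matching-⊕⁺ : ∀ {F : Fin k → Subset n} {F′ : Fin l → Subset n} {A A₁ A₂} →
              Matching F A₁ → Matching F′ A₂ → A ⊆ A₁ ∪ A₂ → Matching (F ⊕ F′) A
matching-⊕⁺ {k = k} {l = l} {F = F} {F′} μ₁ μ₂ A⊆A₁∪A₂ = matching-⊆ A⊆A₁∪A₂ (matching-∪
  (matching-reslot (_↑ˡ l) (↑ˡ-injective l _ _) (subst (_ ∈_) (sym (⊕-↑ˡ F F′ _))) μ₁)
  (matching-reslot (k ↑ʳ_) (↑ʳ-injective k _ _) (subst (_ ∈_) (sym (⊕-↑ʳ F F′ _))) μ₂)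
  λ _ _ _ _ → ↑ˡ≢↑ʳ _ _)

matching-⊕⁻ : ∀ {F : Fin k → Subset n} {F′ : Fin l → Subset n} {A} → Matching (F ⊕ F′) A →
              ∃₂ λ A₁ A₂ → Matching F A₁ × Matching F′ A₂ × A₁ ⊆ A × A₂ ⊆ A × A ⊆ A₁ ∪ A₂
matching-⊕⁻ {k = k} {n = n} {l = l} {F = F} {F′} {A} μ =
  _ , _ , matching-preimage μ (_↑ˡ l) (subst (_ ∈_) (⊕-↑ˡ F F′ _)) ,
          matching-preimage μ (k ↑ʳ_) (subst (_ ∈_) (⊕-↑ʳ F F′ _)) ,
          preimage⊆ (slot μ) _ , preimage⊆ (slot μ) _ , cover
  where
  A₁∪A₂ : Subset n
  A₁∪A₂ = preimage (slot μ) (_↑ˡ l) ∪ preimage (slot μ) (k ↑ʳ_)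
  cover : A ⊆ A₁∪A₂
  cover {a} a∈ = by-side (split k (slot μ a a∈)) refl
    where
    by-side : ∀ {s} → Split k l s → slot μ a a∈ ≡ s → a ∈ A₁∪A₂
    by-side (left i)  eq = x∈p∪q⁺ (inj₁ (∈-subset⁺ (routedThrough? (slot μ) _) (a∈ , i , eq)))
    by-side (right j) eq = x∈p∪q⁺ (inj₂ (∈-subset⁺ (routedThrough? (slot μ) _) (a∈ , j , eq)))

matching-++ : ∀ {L : Fin k → Subset m} {R : Fin k → Subset n} {G : Fin k → Subset (m + n)} {P Q}
              (μ₁ : Matching L P) (μ₂ : Matching R Q) → (∀ x x∈ y y∈ → slot μ₁ x x∈ ≢ slot μ₂ y y∈) →
              (∀ {i x} → x ∈ L i → x ↑ˡ n ∈ G i) → (∀ {i y} → y ∈ R i → m ↑ʳ y ∈ G i) →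
              Matching G (P ++ Q)
matching-++ {m = m} {n} {G = G} {P} {Q} (matching f f-inj f∈) (matching f′ f′-inj f′∈) disjoint L⇒G R⇒G =
  matching h h-inj h∈
  where
  h : Assignment (P ++ Q) _
  h a a∈ with split m a
  ... | left x  = f x (∈-++⁻ˡ P a∈)
  ... | right y = f′ y (∈-++⁻ʳ P a∈)
  h-inj : InjectiveOn (P ++ Q) h
  h-inj a b a∈ b∈ eq with split m a | split m b
  ... | left x  | left x′  = cong (_↑ˡ n) (f-inj x x′ _ _ eq)
  ... | left x  | right y  = contradiction eq (disjoint x _ y _)
  ... | right y | left x   = contradiction (sym eq) (disjoint x _ y _)
  ... | right y | right y′ = cong (m ↑ʳ_) (f′-inj y y′ _ _ eq)
  h∈ : ∀ a a∈ → a ∈ G (h a a∈)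
  h∈ a a∈ with split m a
  ... | left x  = L⇒G (f∈ x _)
  ... | right y = R⇒G (f′∈ y _)

matching-take : ∀ {G : Fin k → Subset (m + n)} {L : Fin k → Subset m} {A} → Matching G A →
                (∀ {i x} → x ↑ˡ n ∈ G i → x ∈ L i) → Matching L (take m A)
matching-take {n = n} {A = A} (matching f f-inj f∈) G⇒L = matching
  (λ x x∈ → f (x ↑ˡ n) (∈-take⁻ A x∈)) (λ x y _ _ → ↑ˡ-injective n x y ∘ f-inj _ _ _ _)
  (λ _ _ → G⇒L (f∈ _ _))

matching-drop : ∀ {G : Fin k → Subset (m + n)} {R : Fin k → Subset n} {A} → Matching G A →
                (∀ {i y} → m ↑ʳ y ∈ G i → y ∈ R i) → Matching R (drop m A)
matching-drop {m = m} {A = A} (matching f f-inj f∈) G⇒R = matching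
  (λ y y∈ → f (m ↑ʳ y) (∈-drop⁻ A y∈)) (λ x y _ _ → ↑ʳ-injective m x y ∘ f-inj _ _ _ _)
  (λ _ _ → G⇒R (f∈ _ _))

matching⇒∣A∣≤∣I∣ : ∀ {F : Fin k → Subset n} {A} {I : Subset k} → Matching F A →
                   (∀ {i a} → a ∈ F i → i ∈ I) → ∣ A ∣ ≤ ∣ I ∣
matching⇒∣A∣≤∣I∣ (matching f f-inj f∈) F⊆I = Injection⇒∣p∣≤∣q∣ (f , f-inj , λ a a∈ → F⊆I (f∈ a a∈))

matching-into-free-slots : ∀ {Z : Subset n} {I J : Subset k} → ∣ Z ∣ ≤ ∣ I ─ J ∣ →
                           Σ (Matching ((λ _ → ⊤) ↾ I) Z) λ μ → ∀ z z∈ → slot μ z z∈ ∉ J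
matching-into-free-slots {Z = Z} {I} {J} ∣Z∣≤∣I─J∣ with ∣p∣≤∣q∣⇒Injection Z (I ─ J) ∣Z∣≤∣I─J∣
... | h , h-inj , h∈ = matching h h-inj (λ z z∈ → ∈↾⁺ (proj₁ (x∈p─q⁻ I J (h∈ z z∈))) ∈⊤) ,
                       λ z z∈ → proj₂ (x∈p─q⁻ I J (h∈ z z∈))

+≤+⇒∸≤∸ : ∀ a {b c d} → a + b ≤ c + d → b ∸ d ≤ c ∸ a
+≤+⇒∸≤∸ a {b} {c} {d} a+b≤c+d = begin
  b ∸ d             ≡⟨ [m+n]∸[m+o]≡n∸o a b d ⟨
  (a + b) ∸ (a + d) ≤⟨ ∸-monoˡ-≤ (a + d) a+b≤c+d ⟩
  (c + d) ∸ (a + d) ≡⟨ cong₂ _∸_ (+-comm c d) (+-comm a d) ⟩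
  (d + c) ∸ (d + a) ≡⟨ [m+n]∸[m+o]≡n∸o d c a ⟩
  c ∸ a             ∎
  where open ≤-Reasoning

freeProductFamily : (Fin k → Subset m) → Subset k → (Fin l → Subset n) → Fin (k + l) → Subset (m + n)
freeProductFamily FM I FN = ((λ i → FM i ++ ⊤) ↾ I) ⊕ (λ j → ⊥ ++ FN j)

module _ (M : Matroid m) (N : Matroid n) {FM : Fin k → Subset m} {I : Subset k} {FN : Fin l → Subset n}
         (presentsM : Presents (Indep M) (FM ↾ I)) (rankM : IsRank M ⊤ ∣ I ∣)
         (presentsN : Presents (Indep N) FN) where

  freeProduct⇒matching : ∀ A → FreeProductIndep M N A → Matching (freeProductFamily FM I FN) A
  freeProduct⇒matching A
    (AS-indep , ρM , ρS , ρT , rkM , rkS , ((Y , Y⊆AT , Y-indep , ∣Y∣≡ρT) , _) , cond) =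
    matching-⊕⁺ matchingM matchingN (A⊆take++drop─Y∪⊥++Y A Y)
    where
    AS : Subset m
    AS = take m A
    AT : Subset n
    AT = drop m A
    hS : Matching (FM ↾ I) AS
    hS = Equivalence.to (presentsM AS) AS-indep
    Z : Subset n
    Z = AT ─ Y
    ∣Z∣≤∣I∣∸∣AS∣ : ∣ Z ∣ ≤ ∣ I ∣ ∸ ∣ AS ∣
    ∣Z∣≤∣I∣∸∣AS∣ = begin
      ∣ Z ∣          ≤⟨ ∣p─q∣≤∣p∣∸∣q∣ Y⊆AT ⟩
      ∣ AT ∣ ∸ ∣ Y ∣ ≡⟨ cong (∣ AT ∣ ∸_) ∣Y∣≡ρT ⟩
      ∣ AT ∣ ∸ ρT    ≤⟨ cond ⟩
      ρM ∸ ρS        ≡⟨ cong₂ _∸_ (rank-unique {M = M} rkM rankM)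
                                  (rank-unique {M = M} rkS (indep⇒IsRank {M = M} AS-indep)) ⟩
      ∣ I ∣ ∸ ∣ AS ∣ ∎
      where open ≤-Reasoning
    leftover : Σ (Matching ((λ _ → ⊤) ↾ I) Z) λ μ → ∀ z z∈ → slot μ z z∈ ∉ image (slot hS)
    leftover = matching-into-free-slots
      (≤-trans ∣Z∣≤∣I∣∸∣AS∣ (∣p∣∸∣A∣≤∣p─image∣ I (slot hS) (slot-injective hS)))
    disjoint : ∀ x x∈ z z∈ → slot hS x x∈ ≢ slot (proj₁ leftover) z z∈
    disjoint x x∈ z z∈ eq = proj₂ leftover z z∈ (subst (_∈ image (slot hS)) eq (f∈image (slot hS) x x∈))
    matchingM : Matching ((λ i → FM i ++ ⊤) ↾ I) (AS ++ Z)
    matchingM = matching-++ hS (proj₁ leftover) disjoint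
      (λ x∈ → let i∈I , x∈FM = ∈↾⁻ x∈ in ∈↾⁺ i∈I (∈-++⁺ˡ x∈FM))
      (λ y∈ → ∈↾⁺ (proj₁ (∈↾⁻ y∈)) (∈-++⁺ʳ (FM _) ∈⊤))
    matchingN : Matching (λ j → ⊥ ++ FN j) (⊥ ++ Y)
    matchingN = matching-++ {L = λ _ → ⊥} matching-⊥ (Equivalence.to (presentsN Y) Y-indep)
      (λ _ x∈ → contradiction x∈ ∉⊥) (λ x∈ → contradiction x∈ ∉⊥) (∈-++⁺ʳ ⊥)

  matching⇒freeProduct : ∀ A → Matching (freeProductFamily FM I FN) A → FreeProductIndep M N A
  matching⇒freeProduct A μ with matching-⊕⁻ μ
  ... | A₁ , A₂ , μ₁ , μ₂ , _ , A₂⊆A , A⊆A₁∪A₂ with rank-exists N (indep? N presentsN) (drop m A)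
  ...   | ρT , rkT = AS-indep , ∣ I ∣ , ∣ AS ∣ , ρT , rankM , indep⇒IsRank {M = M} AS-indep , rkT , cond
    where
    AS : Subset m
    AS = take m A
    AT : Subset n
    AT = drop m A
    take-A₂-empty : ∀ {x} → x ∉ take m A₂
    take-A₂-empty x∈ = ∉⊥ (∈slot (matching-take {L = λ _ → ⊥} μ₂ (∈-++⁻ˡ ⊥)) _ x∈)
    ∣take-A₂∣≡0 : ∣ take m A₂ ∣ ≡ 0
    ∣take-A₂∣≡0 = trans (cong ∣_∣ (Empty-unique (take-A₂-empty ∘ proj₂))) (∣⊥∣≡0 m)
    AS⊆ : AS ⊆ take m A₁
    AS⊆ x∈ with x∈p∪q⁻ A₁ A₂ (A⊆A₁∪A₂ (∈-take⁻ A x∈))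
    ... | inj₁ ∈A₁ = ∈-take⁺ A₁ ∈A₁
    ... | inj₂ ∈A₂ = contradiction (∈-take⁺ A₂ ∈A₂) take-A₂-empty
    AS-indep : Indep M AS
    AS-indep = Equivalence.from (presentsM AS) (matching-⊆ AS⊆ (matching-take μ₁ λ x∈ →
      let i∈I , x∈FM++⊤ = ∈↾⁻ x∈ in ∈↾⁺ i∈I (∈-++⁻ˡ (FM _) x∈FM++⊤)))
    ∣A₂∣≤ρT : ∣ A₂ ∣ ≤ ρT
    ∣A₂∣≤ρT = begin
      ∣ A₂ ∣                        ≡⟨ ∣A∣≡∣take∣+∣drop∣ {m = m} A₂ ⟩
      ∣ take m A₂ ∣ + ∣ drop m A₂ ∣ ≡⟨ cong (_+ ∣ drop m A₂ ∣) ∣take-A₂∣≡0 ⟩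
      ∣ drop m A₂ ∣                 ≤⟨ proj₂ rkT (drop m A₂) (∈-drop⁺ A ∘ A₂⊆A ∘ ∈-drop⁻ A₂)
                                         (Equivalence.from (presentsN _) (matching-drop μ₂ (∈-++⁻ʳ ⊥))) ⟩
      ρT                            ∎
      where open ≤-Reasoning
    cond : ∣ AT ∣ ∸ ρT ≤ ∣ I ∣ ∸ ∣ AS ∣
    cond = +≤+⇒∸≤∸ ∣ AS ∣ (begin
      ∣ AS ∣ + ∣ AT ∣ ≡⟨ ∣A∣≡∣take∣+∣drop∣ {m = m} A ⟨
      ∣ A ∣           ≤⟨ p⊆q∪r⇒∣p∣≤∣q∣+∣r∣ A⊆A₁∪A₂ ⟩
      ∣ A₁ ∣ + ∣ A₂ ∣ ≤⟨ +-mono-≤ (matching⇒∣A∣≤∣I∣ μ₁ (proj₁ ∘ ∈↾⁻)) ∣A₂∣≤ρT ⟩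
      ∣ I ∣ + ρT      ∎)
      where open ≤-Reasoning

proposition4p13 : ∀ {m n} (M : Matroid m) (N : Matroid n) →
                    IsTransversal M → IsTransversal N →
                    IsTransversalIndep (FreeProductIndep M N)
proposition4p13 M N (k , FM , presentsM) (l , FN , presentsN)
  with rank-sized-presentation {M = M} (λ A → PT⇔Matching ⇔-∘ presentsM A)
... | I , presentsM↾ , rankM = k + l , freeProductFamily FM I FN , λ A → mk⇔
  (Equivalence.from PT⇔Matching ∘ freeProduct⇒matching M N presentsM↾ rankM presentsN′ A)
  (matching⇒freeProduct M N presentsM↾ rankM presentsN′ A ∘ Equivalence.to PT⇔Matching)
  where
  presentsN′ : Presents (Indep N) FN
  presentsN′ A = PT⇔Matching ⇔-∘ presentsN A
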